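{- Let $H$ be the graph on $9$ vertices consisting of a triangle $\Delta_0$ on the vertices $0,1,2$ together with, for each $i\in\{0,1,2\}$, a triangle $\Delta_i^*$ on the vertices $i,p_i,q_i$, where $p_0,q_0,p_1,q_1,p_2,q_2$ are six new, pairwise distinct vertices, and let the 2-hive be $\mathcal H=H\,\square\,H$. Then there exist $4^9=262144$ distinct isolated $2$-perfect truncated-metric codes in $\mathcal H$.
   Context: A tersquare is a copy of $K_3\square K_3$. The 2-hive $\mathcal H$ is the union of the $16$ tersquares $\Delta\times\Delta'$ with $\Delta,\Delta'\in\{\Delta_0,\Delta_0^*,\Delta_1^*,\Delta_2^*\}$. Truncated distance on $\mathcal H$: for vertices $u,v$, $\rho(u,v)$ is the graph distance between $u$ and $v$ if $u$ and $v$ lie in a common tersquare of $\mathcal H$, and $\rho(u,v)=3$ otherwise. For $S\subseteq V(\mathcal H)$ let $\rho(u,S)=\min_{s\in S}\rho(u,s)$. A set $S\subseteq V(\mathcal H)$ is an isolated $2$-perfect truncated-metric code ($2$-PTMC) if no two vertices of $S$ are adjacent (so every component of the induced subgraph $[S]$ is a single vertex), for every vertex $u$ there is a unique $s\in S$ with $\rho(u,s)=\rho(u,S)$, and the truncated spheres $\{u\in V(\mathcal H):\rho(u,s)\le 2\}$, $s\in S$, form a partition of $V(\mathcal H)$. -}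

module Defs where

open import Data.Nat using (ℕ; zero; suc; _≤_; _<_)
open import Data.Fin using (Fin; #_)
open import Data.Bool using (Bool; true)
open import Data.Product using (_×_; _,_; Σ; ∃; ∃-syntax)
open import Data.Sum using (_⊎_)
open import Data.List using (List; _∷_; [])
open import Data.List.Membership.Propositional using (_∈_)
open import Relation.Nullary using (¬_)
open import Relation.Binary.PropositionalEquality using (_≡_; _≢_)

-- The graph H on 9 vertices.
-- Vertex encoding (Fin 9):  0,1,2  are 0,1,2;
--   p₀ = 3, q₀ = 4, p₁ = 5, q₁ = 6, p₂ = 7, q₂ = 8.

HV : Set
HV = Fin 9

triangle : Fin 4 → List HV
triangle Fin.zero                         = # 0 ∷ # 1 ∷ # 2 ∷ []
triangle (Fin.suc Fin.zero)               = # 0 ∷ # 3 ∷ # 4 ∷ []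
triangle (Fin.suc (Fin.suc Fin.zero))     = # 1 ∷ # 5 ∷ # 6 ∷ []
triangle (Fin.suc (Fin.suc (Fin.suc _)))  = # 2 ∷ # 7 ∷ # 8 ∷ []

AdjH : HV → HV → Set
AdjH a b = a ≢ b × ∃[ t ] (a ∈ triangle t × b ∈ triangle t)

V : Set
V = HV × HV

Adj : V → V → Set
Adj (a , b) (a' , b') = (a ≡ a' × AdjH b b') ⊎ (AdjH a a' × b ≡ b')

data Walk : V → V → ℕ → Set where
  nil  : ∀ {u} → Walk u u 0
  cons : ∀ {u w v n} → Adj u w → Walk w v n → Walk u v (suc n)

Dist : V → V → ℕ → Set
Dist u v d = Walk u v d × (∀ m → m < d → ¬ Walk u v m)

CommonTersquare : V → V → Set
CommonTersquare (a , b) (a' , b') =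
  ∃[ t ] ∃[ t' ] ((a ∈ triangle t × a' ∈ triangle t) × (b ∈ triangle t' × b' ∈ triangle t'))

Rho : V → V → ℕ → Set
Rho u v d = (CommonTersquare u v × Dist u v d) ⊎ (¬ CommonTersquare u v × d ≡ 3)

VSet : Set
VSet = V → Bool

_∈S_ : V → VSet → Set
v ∈S S = S v ≡ true

RhoSet : V → VSet → ℕ → Set
RhoSet u S d = (∃[ s ] (s ∈S S × Rho u s d))
             × (∀ s e → s ∈S S → Rho u s e → d ≤ e)

Nearest : VSet → V → V → Set
Nearest S u s = s ∈S S × ∃[ d ] (Rho u s d × RhoSet u S d)

InSphere : V → V → Set
InSphere s u = ∃[ d ] (Rho u s d × d ≤ 2)

record Isolated2PTMC (S : VSet) : Set where
  field
    isolated  : ∀ s s' → s ∈S S → s' ∈S S → ¬ Adj s s'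
    uniqueNearest :
      ∀ u → ∃[ s ] (Nearest S u s × (∀ s' → Nearest S u s' → s' ≡ s))
    spheresPartition :
      ∀ u → ∃[ s ] ((s ∈S S × InSphere s u)
                   × (∀ s' → s' ∈S S → InSphere s' u → s' ≡ s))

-- Every vertex of H lies in exactly one star triangle Δᵢ*, so the nine star tersquares
-- Δᵢ* × Δⱼ* partition 𝓗.  Pick in each of them one of its four vertices (pᵢ or qᵢ , pⱼ or qⱼ);
-- this gives 4⁹ different sets.  A leaf pᵢ, qᵢ lies in no triangle but Δᵢ*, so the only tersquare
-- through a vertex u that contains a picked vertex is the star tersquare of u.  Hence u is at
-- truncated distance ≤ 2 (the Hamming distance, inside a tersquare) from the codeword of its star
-- tersquare and at distance 3 from every other codeword, which gives all the code properties.
module Submission where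

open import Defs
open import Data.Nat as ℕ using (ℕ; _^_; _+_; _≤_; z≤n; s≤s)
open import Data.Nat.Properties using (≤-trans; ≤-reflexive; n≮n; +-suc; +-mono-≤; +-monoˡ-≤; +-monoʳ-≤; <⇒≱)
open import Data.Fin using (Fin; zero; suc; #_; _≟_; combine; remQuot; finToFun; funToFin)
open import Data.Fin.Properties using (all?; ¬∀⟶∃¬; combine-remQuot; funToFin-finToFin)
open import Data.Vec using (lookup; _∷_; [])
open import Data.Product using (_×_; _,_; Σ; ∃-syntax; proj₁; proj₂; uncurry)
open import Data.Product.Properties using (≡-dec)
open import Data.Sum using (_⊎_; inj₁; inj₂)
open import Data.List.Membership.Propositional using (_∈_)
open import Data.List.Membership.DecPropositional (_≟_ {9}) using (_∈?_)
open import Function using (_∘_)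
open import Relation.Nullary using (¬_; Dec; yes; no; does; contradiction)
open import Relation.Nullary.Decidable using (_→-dec_; toWitness; dec-true)
open import Relation.Binary.PropositionalEquality
  using (_≡_; _≢_; _≗_; refl; sym; trans; cong; cong₂; subst)

star : Fin 3 → Fin 4
star = suc

starOf : HV → Fin 3
starOf = lookup (# 0 ∷ # 1 ∷ # 2 ∷ # 0 ∷ # 0 ∷ # 1 ∷ # 1 ∷ # 2 ∷ # 2 ∷ [])

leaf : Fin 3 → Fin 2 → HV
leaf zero             zero       = # 3
leaf zero             (suc zero) = # 4
leaf (suc zero)       zero       = # 5
leaf (suc zero)       (suc zero) = # 6
leaf (suc (suc zero)) zero       = # 7
leaf (suc (suc zero)) (suc zero) = # 8

∈-star-starOf : ∀ a → a ∈ triangle (star (starOf a))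
∈-star-starOf = toWitness {a? = all? λ a → a ∈? triangle (star (starOf a))} _

leaf-∈-star : ∀ i x → leaf i x ∈ triangle (star i)
leaf-∈-star = toWitness {a? = all? λ i → all? λ x → leaf i x ∈? triangle (star i)} _

-- A leaf lies in a single triangle of H, its star.
starOf-triangle-leaf : ∀ {a t} i x → a ∈ triangle t → leaf i x ∈ triangle t → starOf a ≡ i
starOf-triangle-leaf {a} {t} = toWitness
  {a? = all? λ a → all? λ t → all? λ i → all? λ x →
          a ∈? triangle t →-dec leaf i x ∈? triangle t →-dec starOf a ≟ i}
  _ a t

leaf-injective : ∀ i {x y} → leaf i x ≡ leaf i y → x ≡ y
leaf-injective i {x} {y} = toWitness
  {a? = all? λ i → all? λ x → all? λ y → leaf i x ≟ leaf i y →-dec x ≟ y} _ i x y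

starOf-leaf : ∀ i x → starOf (leaf i x) ≡ i
starOf-leaf i x = starOf-triangle-leaf i x (leaf-∈-star i x) (leaf-∈-star i x)

mismatch : {A : Set} → Dec A → ℕ
mismatch (yes _) = 0
mismatch (no _)  = 1

mismatch≤1 : {A : Set} (a? : Dec A) → mismatch a? ≤ 1
mismatch≤1 (yes _) = z≤n
mismatch≤1 (no _)  = s≤s z≤n

mismatch-yes : {A : Set} (a? : Dec A) → A → mismatch a? ≡ 0
mismatch-yes (yes _) _ = refl
mismatch-yes (no ¬a) a = contradiction a ¬a

hamming : V → V → ℕ
hamming (a , b) (c , d) = mismatch (a ≟ c) + mismatch (b ≟ d)

hamming≤2 : ∀ u v → hamming u v ≤ 2
hamming≤2 (a , b) (c , d) = +-mono-≤ (mismatch≤1 (a ≟ c)) (mismatch≤1 (b ≟ d))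

hamming-step : ∀ {u w} v → Adj u w → hamming u v ≤ 1 + hamming w v
hamming-step {a , b} {_ , b'} (c , d) (inj₁ (refl , _)) = ≤-trans
  (+-monoʳ-≤ (mismatch (a ≟ c)) (≤-trans (mismatch≤1 (b ≟ d)) (s≤s z≤n)))
  (≤-reflexive (+-suc (mismatch (a ≟ c)) (mismatch (b' ≟ d))))
hamming-step {a , b} {a' , _} (c , d) (inj₂ (_ , refl)) =
  +-monoˡ-≤ (mismatch (b ≟ d)) (≤-trans (mismatch≤1 (a ≟ c)) (s≤s z≤n))

hamming≤length : ∀ {u v n} → Walk u v n → hamming u v ≤ n
hamming≤length {a , b} nil
  rewrite mismatch-yes (a ≟ a) refl | mismatch-yes (b ≟ b) refl = z≤n
hamming≤length {v = v} (cons u~w w⇝v) = ≤-trans (hamming-step v u~w) (s≤s (hamming≤length w⇝v))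

walk-hamming : ∀ {u v} → CommonTersquare u v → Walk u v (hamming u v)
walk-hamming {a , b} {c , d} (t , t' , (a∈t , c∈t) , (b∈t' , d∈t')) with a ≟ c | b ≟ d
... | yes refl | yes refl = nil
... | yes refl | no b≢d   = cons (inj₁ (refl , b≢d , t' , b∈t' , d∈t')) nil
... | no a≢c   | yes refl = cons (inj₂ ((a≢c , t , a∈t , c∈t) , refl)) nil
... | no a≢c   | no b≢d   =
  cons (inj₂ ((a≢c , t , a∈t , c∈t) , refl)) (cons (inj₁ (refl , b≢d , t' , b∈t' , d∈t')) nil)

Rho-hamming : ∀ {u v} → CommonTersquare u v → Rho u v (hamming u v)
Rho-hamming uv = inj₁ (uv , walk-hamming uv , λ m m<h w → <⇒≱ m<h (hamming≤length w))

Rho⇒hamming≤⊎≡3 : ∀ {u v e} → Rho u v e → (CommonTersquare u v × hamming u v ≤ e) ⊎ e ≡ 3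
Rho⇒hamming≤⊎≡3 (inj₁ (uv , w , _)) = inj₁ (uv , hamming≤length w)
Rho⇒hamming≤⊎≡3 (inj₂ (_ , e≡3))    = inj₂ e≡3

Adj-irreflexive : ∀ {u} → ¬ Adj u u
Adj-irreflexive (inj₁ (_ , b≢b , _)) = b≢b refl
Adj-irreflexive (inj₂ ((a≢a , _) , _)) = a≢a refl

Adj⇒CommonTersquare : ∀ {u v} → Adj u v → CommonTersquare u v
Adj⇒CommonTersquare {a , _} (inj₁ (refl , _ , t , b∈t , b'∈t)) =
  star (starOf a) , t , (∈-star-starOf a , ∈-star-starOf a) , (b∈t , b'∈t)
Adj⇒CommonTersquare {_ , b} (inj₂ ((_ , t , a∈t , a'∈t) , refl)) =
  t , star (starOf b) , (a∈t , a'∈t) , (∈-star-starOf b , ∈-star-starOf b)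

-- c i j picks the codeword (leaf i _ , leaf j _) of the star tersquare Δᵢ* × Δⱼ*.
Choice : Set
Choice = Fin 3 → Fin 3 → Fin 2 × Fin 2

codeword : Choice → Fin 3 → Fin 3 → V
codeword c i j = leaf i (proj₁ (c i j)) , leaf j (proj₂ (c i j))

codewordOf : Choice → V → V
codewordOf c (a , b) = codeword c (starOf a) (starOf b)

code : Choice → VSet
code c u = does (≡-dec _≟_ _≟_ u (codewordOf c u))

∈code⇒≡codewordOf : ∀ c {s} → s ∈S code c → s ≡ codewordOf c s
∈code⇒≡codewordOf c {s} s∈ with ≡-dec _≟_ _≟_ s (codewordOf c s)
... | yes s≡ = s≡

codewordOf-codeword : ∀ c c' i j → codewordOf c' (codeword c i j) ≡ codeword c' i j
codewordOf-codeword c c' i j =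
  cong₂ (codeword c') (starOf-leaf i (proj₁ (c i j))) (starOf-leaf j (proj₂ (c i j)))

codeword∈code : ∀ c i j → codeword c i j ∈S code c
codeword∈code c i j = dec-true (≡-dec _≟_ _≟_ _ _) (sym (codewordOf-codeword c c i j))

codewordOf∈code : ∀ c u → codewordOf c u ∈S code c
codewordOf∈code c (a , b) = codeword∈code c (starOf a) (starOf b)

CommonTersquare-codewordOf : ∀ c u → CommonTersquare u (codewordOf c u)
CommonTersquare-codewordOf c (a , b) =
  star (starOf a) , star (starOf b) ,
  (∈-star-starOf a , leaf-∈-star (starOf a) _) , (∈-star-starOf b , leaf-∈-star (starOf b) _)

code-∩-CommonTersquare : ∀ c {u s} → s ∈S code c → CommonTersquare u s → s ≡ codewordOf c u
code-∩-CommonTersquare c {a , b} {s} s∈ (t , t' , (a∈t , s₁∈t) , (b∈t' , s₂∈t')) =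
  trans s≡ (cong₂ (codeword c) (sym a∼s₁) (sym b∼s₂))
  where
  s≡ = ∈code⇒≡codewordOf c s∈
  a∼s₁ : starOf a ≡ starOf (proj₁ s)
  a∼s₁ = starOf-triangle-leaf _ _ a∈t (subst (_∈ triangle t) (cong proj₁ s≡) s₁∈t)
  b∼s₂ : starOf b ≡ starOf (proj₂ s)
  b∼s₂ = starOf-triangle-leaf _ _ b∈t' (subst (_∈ triangle t') (cong proj₂ s≡) s₂∈t')

Rho-code : ∀ c {u s e} → s ∈S code c → Rho u s e →
           (s ≡ codewordOf c u × hamming u s ≤ e) ⊎ e ≡ 3
Rho-code c s∈ r with Rho⇒hamming≤⊎≡3 r
... | inj₁ (us , h≤e) = inj₁ (code-∩-CommonTersquare c s∈ us , h≤e)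
... | inj₂ e≡3        = inj₂ e≡3

module _ (c : Choice) (u : V) where

  private
    s₀ = codewordOf c u
    h₀ = hamming u s₀
    s₀∈ = codewordOf∈code c u
    ρs₀ : Rho u s₀ h₀
    ρs₀ = Rho-hamming (CommonTersquare-codewordOf c u)

  hamming-codewordOf-minimal : ∀ s e → s ∈S code c → Rho u s e → h₀ ≤ e
  hamming-codewordOf-minimal s e s∈ r with Rho-code c s∈ r
  ... | inj₁ (refl , h≤e) = h≤e
  ... | inj₂ refl         = ≤-trans (hamming≤2 u s₀) (s≤s (s≤s z≤n))

  Nearest-codewordOf : Nearest (code c) u s₀
  Nearest-codewordOf = s₀∈ , h₀ , ρs₀ , (s₀ , s₀∈ , ρs₀) , hamming-codewordOf-minimal

  Nearest⇒≡codewordOf : ∀ s → Nearest (code c) u s → s ≡ s₀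
  Nearest⇒≡codewordOf s (s∈ , d , r , _ , d-min) with Rho-code c s∈ r
  ... | inj₁ (s≡s₀ , _) = s≡s₀
  ... | inj₂ refl       = contradiction (≤-trans (d-min s₀ h₀ s₀∈ ρs₀) (hamming≤2 u s₀)) (n≮n 2)

  InSphere-codewordOf : InSphere s₀ u
  InSphere-codewordOf = h₀ , ρs₀ , hamming≤2 u s₀

  InSphere⇒≡codewordOf : ∀ s → s ∈S code c → InSphere s u → s ≡ s₀
  InSphere⇒≡codewordOf s s∈ (d , r , d≤2) with Rho-code c s∈ r
  ... | inj₁ (s≡s₀ , _) = s≡s₀
  ... | inj₂ refl       = contradiction d≤2 (n≮n 2)

code-isolated : ∀ c s s' → s ∈S code c → s' ∈S code c → ¬ Adj s s'
code-isolated c s s' s∈ s'∈ s~s' = Adj-irreflexive (subst (Adj s) s'≡s s~s')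
  where
  s'≡s : s' ≡ s
  s'≡s = trans (code-∩-CommonTersquare c s'∈ (Adj⇒CommonTersquare s~s'))
               (sym (∈code⇒≡codewordOf c s∈))

code-Isolated2PTMC : ∀ c → Isolated2PTMC (code c)
code-Isolated2PTMC c = record
  { isolated         = code-isolated c
  ; uniqueNearest    = λ u → codewordOf c u , Nearest-codewordOf c u , Nearest⇒≡codewordOf c u
  ; spheresPartition = λ u → codewordOf c u
      , (codewordOf∈code c u , InSphere-codewordOf c u) , InSphere⇒≡codewordOf c u
  }

code-determines-choice : ∀ c c' i j → code c (codeword c i j) ≡ code c' (codeword c i j) →
                         c i j ≡ c' i j
code-determines-choice c c' i j same =
  cong₂ _,_ (leaf-injective i (cong proj₁ w≡w')) (leaf-injective j (cong proj₂ w≡w'))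
  where
  w∈c' : codeword c i j ∈S code c'
  w∈c' = trans (sym same) (codeword∈code c i j)
  w≡w' : codeword c i j ≡ codeword c' i j
  w≡w' = trans (∈code⇒≡codewordOf c' w∈c') (codewordOf-codeword c c' i j)

funToFin-cong : ∀ {m n} {f g : Fin m → Fin n} → f ≗ g → funToFin f ≡ funToFin g
funToFin-cong {ℕ.zero} _   = refl
funToFin-cong {ℕ.suc m} f≗g = cong₂ combine (f≗g zero) (funToFin-cong (f≗g ∘ suc))

finToFun-injective : ∀ {m n} {k l : Fin (m ^ n)} → finToFun k ≗ finToFun l → k ≡ l
finToFun-injective {m} {n} {k} {l} k≗l = trans (sym (funToFin-finToFin {n} {m} k))
  (trans (funToFin-cong {n} {m} k≗l) (funToFin-finToFin {n} {m} l))

remQuot-injective : ∀ {m} n {k l : Fin (m ℕ.* n)} → remQuot {m} n k ≡ remQuot n l → k ≡ l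
remQuot-injective {m} n {k} {l} eq = trans (sym (combine-remQuot {m} n k))
  (trans (cong (uncurry combine) eq) (combine-remQuot {m} n l))

-- A number below 4⁹ read as nine base-4 digits, one per star tersquare, each digit read as two bits.
choice : Fin (4 ^ 9) → Choice
choice k i j = remQuot {2} 2 (finToFun {4} {9} k (combine i j))

choice-injective : ∀ {k l} → (∀ i j → choice k i j ≡ choice l i j) → k ≡ l
choice-injective {k} {l} same = finToFun-injective {4} {9} λ m →
  remQuot-injective 2 (subst (λ m → remQuot {2} 2 (finToFun k m) ≡ remQuot 2 (finToFun l m))
                             (combine-remQuot {3} 3 m) (uncurry same (remQuot {3} 3 m)))

choice-differs : ∀ {k l} → k ≢ l → ∃[ i ] ∃[ j ] choice k i j ≢ choice l i j
choice-differs {k} {l} k≢l =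
  let i , ¬agree-i = ¬∀⟶∃¬ 3 (λ i → ∀ j → agree i j) (λ i → all? (agree? i))
                             (λ agree-all → k≢l (choice-injective agree-all))
      j , disagree = ¬∀⟶∃¬ 3 (agree i) (agree? i) ¬agree-i
  in  i , j , disagree
  where
  agree : Fin 3 → Fin 3 → Set
  agree i j = choice k i j ≡ choice l i j
  agree? : ∀ i j → Dec (agree i j)
  agree? i j = ≡-dec _≟_ _≟_ (choice k i j) (choice l i j)

theorem6 : Σ (Fin (4 ^ 9) → VSet) λ C →
             (∀ i → Isolated2PTMC (C i))
             × (∀ i j → i ≢ j → ∃[ v ] (C i v ≢ C j v))
theorem6 = code ∘ choice , code-Isolated2PTMC ∘ choice , codes-differ
  where
  codes-differ : ∀ k l → k ≢ l → ∃[ v ] (code (choice k) v ≢ code (choice l) v)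
  codes-differ k l k≢l =
    let i , j , disagree = choice-differs k≢l
    in  codeword (choice k) i j , disagree ∘ code-determines-choice (choice k) (choice l) i j
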